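{- If a quiver $Q$ has a rank function, then $\dim(\operatorname{DE}(Q))\le c(Q)-1$, where $c(Q)=\#Q_0-\#\pi_0(Q)$.
   Context: A quiver is a pair $Q=(Q_0,Q_1)$ with $Q_0$ finite and $Q_1\subset (Q_0\times Q_0)\setminus\{(v,v)\}$. $\varepsilon_{(v,w)}=\kappa_{\{v\}}-\kappa_{\{w\}}\in\mathbb{R}^{Q_0}$ with $\kappa_{\{v\}}$ the indicator function of $v$, and $\operatorname{DE}(Q)=\operatorname{conv}\{\varepsilon_{(v,w)}\mid (v,w)\in Q_1\}$. $\pi_0(Q)$ is the set of connected components (connectivity via undirected walks). A rank function of $Q$ is $\rho:Q_0\to\mathbb{R}$ with $\rho(v)+1=\rho(w)$ for each $(v,w)\in Q_1$.
   Formalization: The rank function ρ takes rational values, and points of DE(Q) have rational coordinates, with rational convex-combination and affine-independence coefficients, rather than real ones. -}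

module Defs where

open import Data.Nat using (ℕ; zero; suc)
open import Data.Fin using (Fin; zero; suc)
open import Data.Fin.Properties using (_≟_)
open import Data.List using (List; length; lookup)
open import Data.List.Membership.Propositional using (_∈_)
open import Data.List.Relation.Unary.All using (All)
open import Data.Product using (_×_; _,_; Σ; ∃)
open import Data.Integer using (ℤ; +_; _-_)
open import Data.Rational using (ℚ; 0ℚ; 1ℚ; _+_; _*_; -_; _≤_)
open import Relation.Binary.PropositionalEquality using (_≡_; _≢_)
open import Relation.Nullary using (yes; no; ¬_)
open import Function using (Surjective)

-- A quiver on the vertex set Q₀ = Fin n.  Q₁ is given as a list of
-- ordered pairs (v , w) with v ≠ w (duplicates are harmless: they do not
-- change DE(Q), π₀(Q) or the notion of rank function).
record Quiver : Set where
  field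
    n      : ℕ
    arrows : List (Fin n × Fin n)
    loopless : All (λ (a : Fin n × Fin n) → Data.Product.proj₁ a ≢ Data.Product.proj₂ a) arrows
open Quiver public

Pt : ℕ → Set
Pt k = Fin k → ℚ

Σ[<_]_ : (m : ℕ) → (Fin m → ℚ) → ℚ
Σ[< zero ] f = 0ℚ
Σ[< suc m ] f = f zero + Σ[< m ] (λ i → f (suc i))

κ : ∀ {k} → Fin k → Pt k
κ v j with j ≟ v
... | yes _ = 1ℚ
... | no  _ = 0ℚ

ε : ∀ {k} → Fin k × Fin k → Pt k
ε (v , w) j = κ v j + (- κ w j)

InConv : ∀ {k} → List (Pt k) → Pt k → Set
InConv {k} S x =
  Σ (Fin (length S) → ℚ) λ λs →
    (∀ i → 0ℚ ≤ λs i) × (Σ[< length S ] λs ≡ 1ℚ) ×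
    (∀ j → x j ≡ Σ[< length S ] (λ i → λs i * lookup S i j))

InDE : (Q : Quiver) → Pt (n Q) → Set
InDE Q = InConv (Data.List.map ε (arrows Q))

AffinelyIndependent : ∀ {k m} → (Fin m → Pt k) → Set
AffinelyIndependent {k} {m} p =
  (c : Fin m → ℚ) → Σ[< m ] c ≡ 0ℚ →
  (∀ j → Σ[< m ] (λ i → c i * p i j) ≡ 0ℚ) → ∀ i → c i ≡ 0ℚ

-- dim P ≤ d  :  every affinely independent family of points of P has at
-- most d + 1 members (dim ∅ = -1, dim of a nonempty set = dim of affine hull).
DimLE : ∀ {k} → (Pt k → Set) → ℤ → Set
DimLE {k} P d =
  (m : ℕ) (p : Fin m → Pt k) → (∀ i → P (p i)) → AffinelyIndependent p →
  Data.Integer._≤_ (+ m - + 1) d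

data Connected (Q : Quiver) : Fin (n Q) → Fin (n Q) → Set where
  here : ∀ {v} → Connected Q v v
  fwd  : ∀ {u v w} → (u , v) ∈ arrows Q → Connected Q v w → Connected Q u w
  bwd  : ∀ {u v w} → (v , u) ∈ arrows Q → Connected Q v w → Connected Q u w

-- #π₀(Q) = k : there is a surjection Q₀ → Fin k whose fibres are exactly
-- the connected components (i.e. a bijection π₀(Q) ≃ Fin k).
NumComponents : Quiver → ℕ → Set
NumComponents Q k =
  Σ (Fin (n Q) → Fin k) λ f →
    Surjective _≡_ _≡_ f ×
    (∀ u v → (f u ≡ f v → Connected Q u v) × (Connected Q u v → f u ≡ f v))

IsRankFunction : (Q : Quiver) → (Fin (n Q) → ℚ) → Set
IsRankFunction Q ρ = ∀ {v w} → (v , w) ∈ arrows Q → ρ v + 1ℚ ≡ ρ w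

-- Every connected component C gives a linear form (the indicator of C) that
-- vanishes on DE(Q), because both ends of an arrow lie in one component; a
-- rank function ρ gives a linear form that is constantly -1 on DE(Q). Given
-- affinely independent points p₁, …, pₘ of DE(Q), adjoin one basis vector
-- κ_{r_C} for a representative r_C of each component: the component forms
-- kill the coefficients of the κ_{r_C}, ρ then forces the remaining
-- coefficients to sum to 0, and affine independence kills them. So m + #π₀(Q)
-- vectors of ℚ^{Q₀} are linearly independent, whence m ≤ c(Q).
module Submission where

open import Defs
open import Data.Nat using (ℕ)
open import Data.Fin using (Fin)
open import Data.Product using (Σ)
open import Data.Integer using (+_; _-_)
open import Data.Rational using (ℚ)

open import Algebra.Bundles using (CommutativeMonoid; CommutativeRing)
open import Data.Nat as ℕ using (zero; suc; _≤_; _<_; s≤s)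
import Data.Nat.Properties as ℕ
import Data.Integer as ℤ
import Data.Integer.Properties as ℤ
open import Data.Fin using (zero; suc; punchIn; splitAt; _↑ˡ_; _↑ʳ_)
open import Data.Fin.Properties
  using (all?; ¬∀⟶∃¬; punchInᵢ≢i; punchIn-punchOut; splitAt⁻¹-↑ˡ; splitAt⁻¹-↑ʳ)
  renaming (_≟_ to _≟ᶠ_)
open import Data.Vec.Functional using (_∷_; _++_)
open import Data.Vec.Functional.Properties using (lookup-++ˡ; lookup-++ʳ)
open import Data.List using (List; length; lookup)
open import Data.List.Membership.Propositional using (_∈_)
open import Data.List.Membership.Propositional.Properties using (∈-lookup; ∈-map⁻)
open import Data.Product using (_×_; _,_; ∃; proj₁; proj₂)
open import Data.Sum using (inj₁; inj₂)
open import Data.Rational using (0ℚ; 1ℚ; _+_; _*_; -_; 1/_)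
import Data.Rational as ℚ
import Data.Rational.Properties as ℚ
open import Data.Rational.Solver using (module +-*-Solver)
open import Algebra.Properties.Semiring.Sum (CommutativeRing.semiring ℚ.+-*-commutativeRing)
  using (sum; sum-syntax; sum-cong-≗; sum-replicate-zero; sum-remove; ∑-distrib-+; ∑-comm;
         *-distribˡ-sum; *-distribʳ-sum)
open import Algebra.Properties.CommutativeSemigroup
  (CommutativeMonoid.commutativeSemigroup ℚ.*-1-commutativeMonoid) using (x∙yz≈y∙xz)
open import Function using (_∘_)
open import Relation.Binary.PropositionalEquality
open import Relation.Nullary using (yes; no; contradiction)

open +-*-Solver using (solve; _:=_; _:+_; _:*_; :-_; con)
open ≡-Reasoning

Σ[<]≡sum : ∀ m (f : Fin m → ℚ) → Σ[< m ] f ≡ sum f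
Σ[<]≡sum zero    f = refl
Σ[<]≡sum (suc m) f = cong (λ z → f zero + z) (Σ[<]≡sum m (f ∘ suc))

sum-zero : ∀ {m} {f : Fin m → ℚ} → (∀ i → f i ≡ 0ℚ) → sum f ≡ 0ℚ
sum-zero {m} f≗0 = trans (sum-cong-≗ f≗0) (sum-replicate-zero m)

sum-↑ : ∀ m k (h : Fin (m ℕ.+ k) → ℚ) →
  sum h ≡ ∑[ i < m ] h (i ↑ˡ k) + ∑[ C < k ] h (m ↑ʳ C)
sum-↑ zero    k h = sym (ℚ.+-identityˡ (sum h))
sum-↑ (suc m) k h =
  trans (cong (λ z → h zero + z) (sum-↑ m k (h ∘ suc))) (sym (ℚ.+-assoc (h zero) _ _))

↑-cases : ∀ {m k} (P : Fin (m ℕ.+ k) → Set) →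
  (∀ i → P (i ↑ˡ k)) → (∀ C → P (m ↑ʳ C)) → ∀ I → P I
↑-cases {m} P left right I with splitAt m I in eq
... | inj₁ i = subst P (splitAt⁻¹-↑ˡ eq) (left i)
... | inj₂ C = subst P (splitAt⁻¹-↑ʳ eq) (right C)

*-cancelʳ-zero : ∀ {x t} → t ≢ 0ℚ → x * t ≡ 0ℚ → x ≡ 0ℚ
*-cancelʳ-zero {x} {t} t≢0 xt≡0 = begin
  x                ≡⟨ ℚ.*-identityʳ x ⟨
  x * 1ℚ           ≡⟨ cong (x *_) (ℚ.*-inverseʳ t) ⟨
  x * (t * 1/ t)   ≡⟨ ℚ.*-assoc x t (1/ t) ⟨
  x * t * 1/ t     ≡⟨ cong (_* 1/ t) xt≡0 ⟩
  0ℚ * 1/ t        ≡⟨ ℚ.*-zeroˡ (1/ t) ⟩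
  0ℚ               ∎
  where instance _ = ℚ.≢-nonZero t≢0

infix 7 _·_
_·_ : ∀ {N} → Pt N → Pt N → ℚ
_·_ {N} w x = ∑[ v < N ] (w v * x v)

linComb : ∀ {m N} → (Fin m → ℚ) → (Fin m → Pt N) → Pt N
linComb {m} c p j = ∑[ i < m ] (c i * p i j)

LinearlyIndependent : ∀ {m N} → (Fin m → Pt N) → Set
LinearlyIndependent p = ∀ c → (∀ j → linComb c p j ≡ 0ℚ) → ∀ i → c i ≡ 0ℚ

NontrivialRelation : ∀ {m N} → (Fin m → Pt N) → Set
NontrivialRelation p = ∃ λ c → (∀ j → linComb c p j ≡ 0ℚ) × ∃ λ i → c i ≢ 0ℚ

·-comm : ∀ {N} (w x : Pt N) → w · x ≡ x · w
·-comm w x = sum-cong-≗ (λ v → ℚ.*-comm (w v) (x v))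

·-zeroʳ : ∀ {N} (w : Pt N) {x : Pt N} → (∀ v → x v ≡ 0ℚ) → w · x ≡ 0ℚ
·-zeroʳ w x≗0 = sum-zero (λ v → trans (cong (w v *_) (x≗0 v)) (ℚ.*-zeroʳ (w v)))

·-linComb : ∀ {m N} (w : Pt N) (c : Fin m → ℚ) (p : Fin m → Pt N) →
  w · linComb c p ≡ ∑[ i < m ] (c i * (w · p i))
·-linComb {m} {N} w c p = begin
  ∑[ v < N ] (w v * ∑[ i < m ] (c i * p i v))
    ≡⟨ sum-cong-≗ (λ v → *-distribˡ-sum (w v) (λ i → c i * p i v)) ⟩
  ∑[ v < N ] ∑[ i < m ] (w v * (c i * p i v))
    ≡⟨ ∑-comm (λ v i → w v * (c i * p i v)) ⟩
  ∑[ i < m ] ∑[ v < N ] (w v * (c i * p i v))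
    ≡⟨ sum-cong-≗ (λ i → sum-cong-≗ (λ v → x∙yz≈y∙xz (w v) (c i) (p i v))) ⟩
  ∑[ i < m ] ∑[ v < N ] (c i * (w v * p i v))
    ≡⟨ sum-cong-≗ (λ i → *-distribˡ-sum (c i) (λ v → w v * p i v)) ⟨
  ∑[ i < m ] (c i * (w · p i))
    ∎

κ-self : ∀ {N} (u : Fin N) → κ u u ≡ 1ℚ
κ-self u with u ≟ᶠ u
... | yes _   = refl
... | no u≢u = contradiction refl u≢u

κ-other : ∀ {N} {u v : Fin N} → v ≢ u → κ u v ≡ 0ℚ
κ-other {u = u} {v} v≢u with v ≟ᶠ u
... | yes v≡u = contradiction v≡u v≢u
... | no _    = refl

·-κ : ∀ {N} (w : Pt N) (u : Fin N) → w · κ u ≡ w u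
·-κ {suc N} w u = begin
  w · κ u                                           ≡⟨ sum-remove {i = u} (λ v → w v * κ u v) ⟩
  w u * κ u u + ∑[ i < N ] (w (punchIn u i) * κ u (punchIn u i))
    ≡⟨ cong₂ _+_ (cong (w u *_) (κ-self u))
                 (·-zeroʳ (w ∘ punchIn u) (λ i → κ-other (punchInᵢ≢i u i))) ⟩
  w u * 1ℚ + 0ℚ                                     ≡⟨ ℚ.+-identityʳ _ ⟩
  w u * 1ℚ                                          ≡⟨ ℚ.*-identityʳ (w u) ⟩
  w u                                               ∎

κ-· : ∀ {N} (u : Fin N) (x : Pt N) → κ u · x ≡ x u
κ-· u x = trans (·-comm (κ u) x) (·-κ x u)

·-ε : ∀ {N} (w : Pt N) (u v : Fin N) → w · ε (u , v) ≡ w u + - w v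
·-ε {N} w u v = begin
  ∑[ j < N ] (w j * (κ u j + - κ v j))
    ≡⟨ sum-cong-≗ (λ j → solve 3 (λ a b c → a :* (b :+ :- c) := a :* b :+ (:- a) :* c)
                                 refl (w j) (κ u j) (κ v j)) ⟩
  ∑[ j < N ] (w j * κ u j + (- w j) * κ v j)
    ≡⟨ ∑-distrib-+ (λ j → w j * κ u j) (λ j → (- w j) * κ v j) ⟩
  w · κ u + (-_ ∘ w) · κ v
    ≡⟨ cong₂ _+_ (·-κ w u) (·-κ (-_ ∘ w) v) ⟩
  w u + - w v
    ∎

conv-level : ∀ {N} {S : List (Pt N)} {x : Pt N} (w : Pt N) (t : ℚ) →
  (∀ y → y ∈ S → w · y ≡ t) → InConv S x → w · x ≡ t
conv-level {S = S} {x} w t level (λs , _ , Σλs≡1 , x≡) = begin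
  w · x
    ≡⟨ sum-cong-≗ (λ v → cong (w v *_) (trans (x≡ v) (Σ[<]≡sum (length S) _))) ⟩
  w · linComb λs (lookup S)
    ≡⟨ ·-linComb w λs (lookup S) ⟩
  ∑[ i < length S ] (λs i * (w · lookup S i))
    ≡⟨ sum-cong-≗ (λ i → cong (λs i *_) (level _ (∈-lookup i))) ⟩
  ∑[ i < length S ] (λs i * t)
    ≡⟨ *-distribʳ-sum t λs ⟨
  sum λs * t
    ≡⟨ cong (_* t) (trans (sym (Σ[<]≡sum _ λs)) Σλs≡1) ⟩
  1ℚ * t
    ≡⟨ ℚ.*-identityˡ t ⟩
  t
    ∎

DE-level : (Q : Quiver) {x : Pt (n Q)} (w : Pt (n Q)) (t : ℚ) →
  (∀ {a} → a ∈ arrows Q → w · ε a ≡ t) → InDE Q x → w · x ≡ t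
DE-level Q w t level = conv-level w t λ y y∈ε[Q₁] →
  let (a , a∈Q₁ , y≡εa) = ∈-map⁻ ε y∈ε[Q₁] in trans (cong (w ·_) y≡εa) (level a∈Q₁)

componentIndicator-DE : (Q : Quiver) {k : ℕ} (f : Fin (n Q) → Fin k) →
  (∀ {u v} → (u , v) ∈ arrows Q → f u ≡ f v) →
  ∀ C {x} → InDE Q x → (κ C ∘ f) · x ≡ 0ℚ
componentIndicator-DE Q f f-arrow C = DE-level Q (κ C ∘ f) 0ℚ λ {(u , v)} uv∈Q₁ → begin
  (κ C ∘ f) · ε (u , v)     ≡⟨ ·-ε (κ C ∘ f) u v ⟩
  κ C (f u) + - κ C (f v)   ≡⟨ cong (λ z → κ C z + - κ C (f v)) (f-arrow uv∈Q₁) ⟩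
  κ C (f v) + - κ C (f v)   ≡⟨ ℚ.+-inverseʳ (κ C (f v)) ⟩
  0ℚ                        ∎

rankFunction-DE : (Q : Quiver) (ρ : Pt (n Q)) → IsRankFunction Q ρ →
  ∀ {x} → InDE Q x → ρ · x ≡ - 1ℚ
rankFunction-DE Q ρ rank = DE-level Q ρ (- 1ℚ) λ {(u , v)} uv∈Q₁ → begin
  ρ · ε (u , v)           ≡⟨ ·-ε ρ u v ⟩
  ρ u + - ρ v             ≡⟨ cong (λ z → ρ u + - z) (rank uv∈Q₁) ⟨
  ρ u + - (ρ u + 1ℚ)      ≡⟨ solve 1 (λ r → r :+ :- (r :+ con 1ℚ) := :- con 1ℚ) refl (ρ u) ⟩
  - 1ℚ                    ∎

linComb-shear : ∀ {m N} (d s : Fin m → ℚ) (y : Fin m → Pt N) (b : Pt N) j →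
  linComb d (λ i j → y i j + s i * b j) j ≡ linComb d y j + ∑[ i < m ] (d i * s i) * b j
linComb-shear {m} d s y b j = begin
  ∑[ i < m ] (d i * (y i j + s i * b j))
    ≡⟨ sum-cong-≗ (λ i → solve 4 (λ d y s b → d :* (y :+ s :* b) := d :* y :+ (d :* s) :* b)
                                 refl (d i) (y i j) (s i) (b j)) ⟩
  ∑[ i < m ] (d i * y i j + d i * s i * b j)
    ≡⟨ ∑-distrib-+ (λ i → d i * y i j) (λ i → d i * s i * b j) ⟩
  linComb d y j + ∑[ i < m ] (d i * s i * b j)
    ≡⟨ cong (λ z → linComb d y j + z) (*-distribʳ-sum (b j) (λ i → d i * s i)) ⟨
  linComb d y j + ∑[ i < m ] (d i * s i) * b j
    ∎

-- One step of Gaussian elimination: clear the pivot coordinate j₀ of p₁, …, pₘ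
-- using p₀; a relation among the cleared vectors lifts to one among the pᵢ.
module Elimination {N m} (p : Fin (suc m) → Pt (suc N)) {j₀ : Fin (suc N)}
                   (pivot≢0 : p zero j₀ ≢ 0ℚ) where

  private instance pivot-nonZero = ℚ.≢-nonZero pivot≢0

  multiplier : Fin m → ℚ
  multiplier i = - (p (suc i) j₀ * 1/ p zero j₀)

  cleared : Fin m → Pt (suc N)
  cleared i j = p (suc i) j + multiplier i * p zero j

  cleared-pivot : ∀ i → cleared i j₀ ≡ 0ℚ
  cleared-pivot i = begin
    y + - (y * 1/ b) * b     ≡⟨ solve 3 (λ y u b → y :+ :- (y :* u) :* b := y :+ :- (y :* (u :* b)))
                                   refl y (1/ b) b ⟩
    y + - (y * (1/ b * b))   ≡⟨ cong (λ z → y + - (y * z)) (ℚ.*-inverseˡ b) ⟩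
    y + - (y * 1ℚ)           ≡⟨ cong (λ z → y + - z) (ℚ.*-identityʳ y) ⟩
    y + - y                  ≡⟨ ℚ.+-inverseʳ y ⟩
    0ℚ                       ∎
    where y = p (suc i) j₀; b = p zero j₀

  lift : NontrivialRelation (λ i → cleared i ∘ punchIn j₀) → NontrivialRelation p
  lift (d , d-rel , i , dᵢ≢0) = (∑[ i < m ] (d i * multiplier i) ∷ d) , rel , suc i , dᵢ≢0
    where
    cleared-rel : ∀ j → linComb d cleared j ≡ 0ℚ
    cleared-rel j with j ≟ᶠ j₀
    ... | yes refl = sum-zero (λ i → trans (cong (d i *_) (cleared-pivot i)) (ℚ.*-zeroʳ (d i)))
    ... | no j≢j₀  =
      subst (λ j → linComb d cleared j ≡ 0ℚ) (punchIn-punchOut (j≢j₀ ∘ sym)) (d-rel _)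
    rel : ∀ j → linComb (∑[ i < m ] (d i * multiplier i) ∷ d) p j ≡ 0ℚ
    rel j = trans (ℚ.+-comm (∑[ i < m ] (d i * multiplier i) * p zero j) (linComb d (p ∘ suc) j))
                  (trans (sym (linComb-shear d multiplier (p ∘ suc) (p zero) j)) (cleared-rel j))

N<m⇒nontrivialRelation : ∀ {N m} → N < m → (p : Fin m → Pt N) → NontrivialRelation p
N<m⇒nontrivialRelation {zero}  {suc m} _ p = (λ _ → 1ℚ) , (λ ()) , zero , λ ()
N<m⇒nontrivialRelation {suc N} {suc m} (s≤s N<m) p with all? (λ j → p zero j ℚ.≟ 0ℚ)
... | yes p₀≡0 = (1ℚ ∷ λ _ → 0ℚ) , rel , zero , λ ()
  where
  rel : ∀ j → 1ℚ * p zero j + ∑[ i < m ] (0ℚ * p (suc i) j) ≡ 0ℚ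
  rel j = cong₂ _+_ (trans (ℚ.*-identityˡ (p zero j)) (p₀≡0 j))
                    (sum-zero (λ i → ℚ.*-zeroˡ (p (suc i) j)))
... | no p₀≢0 with ¬∀⟶∃¬ _ _ (λ j → p zero j ℚ.≟ 0ℚ) p₀≢0
...   | j₀ , pivot≢0 = lift (N<m⇒nontrivialRelation N<m (λ i → cleared i ∘ punchIn j₀))
  where open Elimination p pivot≢0

linearlyIndependent⇒m≤N : ∀ {N m} (p : Fin m → Pt N) → LinearlyIndependent p → m ≤ N
linearlyIndependent⇒m≤N {N} {m} p indep with m ℕ.≤? N
... | yes m≤N = m≤N
... | no m≰N with N<m⇒nontrivialRelation (ℕ.≰⇒> m≰N) p
...   | c , rel , i , cᵢ≢0 = contradiction (indep c rel i) cᵢ≢0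

-- The forms w_C detect the coefficients of the e_C; the form ρ, a nonzero
-- constant on the pᵢ, turns the remaining linear relation into an affine one.
affinelyIndependent⇒linearlyIndependent-++ :
  ∀ {N m k} (p : Fin m → Pt N) (e : Fin k → Pt N) (w : Fin k → Pt N) (ρ : Pt N) (t : ℚ) →
  (∀ C i → w C · p i ≡ 0ℚ) → (∀ C D → w C · e D ≡ κ C D) →
  t ≢ 0ℚ → (∀ i → ρ · p i ≡ t) →
  AffinelyIndependent p → LinearlyIndependent (p ++ e)
affinelyIndependent⇒linearlyIndependent-++ {m = m} {k} p e w ρ t w·p≡0 w·e≡κ t≢0 ρ·p≡t
                                           p-indep c c-rel =
  ↑-cases (λ I → c I ≡ 0ℚ) a≡0 d≡0
  where
  a : Fin m → ℚ
  a i = c (i ↑ˡ k)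
  d : Fin k → ℚ
  d C = c (m ↑ʳ C)

  balance : ∀ u → ∑[ i < m ] (a i * (u · p i)) + ∑[ C < k ] (d C * (u · e C)) ≡ 0ℚ
  balance u = begin
    ∑[ i < m ] (a i * (u · p i)) + ∑[ C < k ] (d C * (u · e C))
      ≡⟨ cong₂ _+_ (sum-cong-≗ (λ i → cong (λ z → a i * (u · z)) (lookup-++ˡ p e i)))
                   (sum-cong-≗ (λ C → cong (λ z → d C * (u · z)) (lookup-++ʳ p e C))) ⟨
    ∑[ i < m ] (a i * (u · (p ++ e) (i ↑ˡ k))) + ∑[ C < k ] (d C * (u · (p ++ e) (m ↑ʳ C)))
      ≡⟨ sum-↑ m k _ ⟨
    ∑[ I < m ℕ.+ k ] (c I * (u · (p ++ e) I))  ≡⟨ ·-linComb u c (p ++ e) ⟨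
    u · linComb c (p ++ e)                     ≡⟨ ·-zeroʳ u c-rel ⟩
    0ℚ                                         ∎

  d≡0 : ∀ C → d C ≡ 0ℚ
  d≡0 C = begin
    d C
      ≡⟨ ·-κ d C ⟨
    d · κ C
      ≡⟨ sum-cong-≗ (λ D → cong (d D *_) (w·e≡κ C D)) ⟨
    ∑[ D < k ] (d D * (w C · e D))
      ≡⟨ ℚ.+-identityˡ _ ⟨
    0ℚ + ∑[ D < k ] (d D * (w C · e D))
      ≡⟨ cong (_+ ∑[ D < k ] (d D * (w C · e D)))
              (sum-zero (λ i → trans (cong (a i *_) (w·p≡0 C i)) (ℚ.*-zeroʳ (a i)))) ⟨
    ∑[ i < m ] (a i * (w C · p i)) + ∑[ D < k ] (d D * (w C · e D))
      ≡⟨ balance (w C) ⟩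
    0ℚ
      ∎

  balanceᵖ : ∀ u → ∑[ i < m ] (a i * (u · p i)) ≡ 0ℚ
  balanceᵖ u = begin
    ∑[ i < m ] (a i * (u · p i))
      ≡⟨ ℚ.+-identityʳ _ ⟨
    ∑[ i < m ] (a i * (u · p i)) + 0ℚ
      ≡⟨ cong (λ z → ∑[ i < m ] (a i * (u · p i)) + z)
              (sum-zero (λ C → trans (cong (_* (u · e C)) (d≡0 C)) (ℚ.*-zeroˡ (u · e C)))) ⟨
    ∑[ i < m ] (a i * (u · p i)) + ∑[ C < k ] (d C * (u · e C))
      ≡⟨ balance u ⟩
    0ℚ
      ∎

  a-rel : ∀ j → Σ[< m ] (λ i → a i * p i j) ≡ 0ℚ
  a-rel j = begin
    Σ[< m ] (λ i → a i * p i j)          ≡⟨ Σ[<]≡sum m _ ⟩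
    ∑[ i < m ] (a i * p i j)             ≡⟨ sum-cong-≗ (λ i → cong (a i *_) (κ-· j (p i))) ⟨
    ∑[ i < m ] (a i * (κ j · p i))       ≡⟨ balanceᵖ (κ j) ⟩
    0ℚ                                   ∎

  a-sum : Σ[< m ] a ≡ 0ℚ
  a-sum = trans (Σ[<]≡sum m a) (*-cancelʳ-zero t≢0 (begin
    sum a * t                            ≡⟨ *-distribʳ-sum t a ⟩
    ∑[ i < m ] (a i * t)                 ≡⟨ sum-cong-≗ (λ i → cong (a i *_) (ρ·p≡t i)) ⟨
    ∑[ i < m ] (a i * (ρ · p i))         ≡⟨ balanceᵖ ρ ⟩
    0ℚ                                   ∎))

  a≡0 : ∀ i → a i ≡ 0ℚ
  a≡0 = p-indep a a-sum a-rel

m+k≤N⇒dimensionBound : ∀ {m k N} → m ℕ.+ k ≤ N → ℤ._≤_ (+ m - + 1) ((+ N - + k) - + 1)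
m+k≤N⇒dimensionBound {m} {k} {N} m+k≤N =
  subst (λ z → ℤ._≤_ (+ m - + 1) (z - + 1)) N-k≡N∸k
        (ℤ.+-monoˡ-≤ (ℤ.- + 1) (ℤ.+≤+ (ℕ.m+n≤o⇒m≤o∸n m m+k≤N)))
  where
  N-k≡N∸k : + (N ℕ.∸ k) ≡ + N - + k
  N-k≡N∸k = sym (trans (ℤ.m-n≡m⊖n N k) (ℤ.⊖-≥ (ℕ.m+n≤o⇒n≤o m m+k≤N)))

corollary3p7 : (Q : Quiver) → Σ (Fin (n Q) → ℚ) (IsRankFunction Q) →
    (k : ℕ) → NumComponents Q k →
    DimLE (InDE Q) ((+ n Q - + k) - + 1)
corollary3p7 Q (ρ , ρ-rank) k (f , f-surj , f-components) m p p∈DE p-indep =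
  m+k≤N⇒dimensionBound {m} {k} (linearlyIndependent⇒m≤N (p ++ κ ∘ rep)
    (affinelyIndependent⇒linearlyIndependent-++ p (κ ∘ rep) (λ C → κ C ∘ f) ρ (- 1ℚ)
      (λ C i → componentIndicator-DE Q f f-arrow C (p∈DE i))
      (λ C D → trans (·-κ (κ C ∘ f) (rep D)) (cong (κ C) (f-rep D)))
      (λ ())
      (λ i → rankFunction-DE Q ρ ρ-rank (p∈DE i))
      p-indep))
  where
  rep : Fin k → Fin (n Q)
  rep D = proj₁ (f-surj D)
  f-rep : ∀ D → f (rep D) ≡ D
  f-rep D = proj₂ (f-surj D) refl
  f-arrow : ∀ {u v} → (u , v) ∈ arrows Q → f u ≡ f v
  f-arrow uv∈Q₁ = proj₂ (f-components _ _) (fwd uv∈Q₁ here)
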